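{- Every recursively enumerable set that is rankable by a partial recursive function is recursive. Equivalently, the class of recursive sets equals the class of recursively enumerable sets that are rankable by a partial recursive function, which also equals the class of recursively enumerable sets that are rankable by a total recursive function.
   Context: All sets are subsets of $\Sigma^\ast$ with $\Sigma=\{0,1\}$, with strings ordered lexicographically in the standard computer-science sense ($\epsilon < 0 < 1 < 00 < \cdots$). A (possibly partial) function $f$ is a ranking function for a set $A$ if $f$ is defined on every element of $A$ and, for each $x\in A$, $f(x)$ is the $i$th string of $\Sigma^\ast$ where $x$ is the $i$th string of $A$ (i.e., $f(x)=\|A^{\le x}\|$, the number of elements of $A$ lexicographically at most $x$); on strings outside $A$ the function may output anything or be undefined. A set is rankable by a partial recursive function (resp. total recursive function) if some partial recursive (resp. total recursive) function from $\Sigma^\ast$ to $\Sigma^\ast$ is a ranking function for it. -}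

module Defs where

open import Data.Nat using (ℕ; zero; suc)
open import Data.Fin using (Fin)
open import Data.Vec using (Vec; []; _∷_; lookup)
open import Data.Product using (Σ; ∃; _×_; _,_)
open import Relation.Nullary using (¬_)
open import Relation.Binary.PropositionalEquality using (_≡_)

-- Strings of Σ* = {0,1}* are identified with natural numbers via the
-- standard length-lexicographic enumeration  ε ↦ 0, 0 ↦ 1, 1 ↦ 2,
-- 00 ↦ 3, ...  Under this identification the lexicographic order on
-- Σ* is the usual order ≤ on ℕ, and partial recursive functions
-- Σ* → Σ* are exactly partial recursive functions ℕ → ℕ.

data PR : ℕ → Set where
  zer  : ∀ {k} → PR k
  succ : PR 1
  proj : ∀ {k} → Fin k → PR k
  comp : ∀ {m k} → PR m → Vec (PR k) m → PR k
  prec : ∀ {k} → PR k → PR (suc (suc k)) → PR (suc k)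
  mu   : ∀ {k} → PR (suc k) → PR k

mutual
  data Eval : ∀ {k} → PR k → Vec ℕ k → ℕ → Set where
    ev-zer  : ∀ {k} {xs : Vec ℕ k} → Eval zer xs 0
    ev-succ : ∀ {x} → Eval succ (x ∷ []) (suc x)
    ev-proj : ∀ {k} {i : Fin k} {xs} → Eval (proj i) xs (lookup xs i)
    ev-comp : ∀ {m k} {f : PR m} {gs : Vec (PR k) m} {xs ys y} →
              EvalVec gs xs ys → Eval f ys y → Eval (comp f gs) xs y
    ev-prec-z : ∀ {k} {f : PR k} {g} {xs y} →
              Eval f xs y → Eval (prec f g) (0 ∷ xs) y
    ev-prec-s : ∀ {k} {f : PR k} {g} {n xs z y} →
              Eval (prec f g) (n ∷ xs) z → Eval g (n ∷ z ∷ xs) y →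
              Eval (prec f g) (suc n ∷ xs) y
    ev-mu   : ∀ {k} {f : PR (suc k)} {xs y} →
              MuFrom f xs 0 y → Eval (mu f) xs y

  data EvalVec : ∀ {k m} → Vec (PR k) m → Vec ℕ k → Vec ℕ m → Set where
    evv-[] : ∀ {k} {xs : Vec ℕ k} → EvalVec [] xs []
    evv-∷  : ∀ {k m} {g : PR k} {gs : Vec (PR k) m} {xs y ys} →
             Eval g xs y → EvalVec gs xs ys → EvalVec (g ∷ gs) xs (y ∷ ys)

  data MuFrom : ∀ {k} → PR (suc k) → Vec ℕ k → ℕ → ℕ → Set where
    mu-here : ∀ {k} {f : PR (suc k)} {xs n} →
              Eval f (n ∷ xs) 0 → MuFrom f xs n n
    mu-next : ∀ {k} {f : PR (suc k)} {xs n v y} →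
              Eval f (n ∷ xs) (suc v) → MuFrom f xs (suc n) y → MuFrom f xs n y

Subset : Set₁
Subset = ℕ → Set

Recursive : Subset → Set
Recursive A = Σ (PR 1) λ e → ∀ x →
  (A x → Eval e (x ∷ []) 1) × (¬ A x → Eval e (x ∷ []) 0)

RecEnum : Subset → Set
RecEnum A = Σ (PR 1) λ e → ∀ x →
  (A x → ∃ λ y → Eval e (x ∷ []) y) × (∃ (λ y → Eval e (x ∷ []) y) → A x)

data CountBelow (A : Subset) : ℕ → ℕ → Set where
  cb-zero : CountBelow A 0 0
  cb-in   : ∀ {n k} → A n → CountBelow A n k → CountBelow A (suc n) (suc k)
  cb-out  : ∀ {n k} → ¬ A n → CountBelow A n k → CountBelow A (suc n) k

-- The program e computes a ranking function for A: for every x ∈ A,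
-- e(x) is defined and equals ‖A^{≤x}‖ (the number of elements of A
-- that are ≤ x, i.e. < x+1).  Nothing is required outside A.
IsRanking : PR 1 → Subset → Set
IsRanking e A = ∀ x → A x →
  Σ ℕ λ k → CountBelow A (suc x) k × Eval e (x ∷ []) k

RankablePartial : Subset → Set
RankablePartial A = Σ (PR 1) λ e → IsRanking e A

Total : PR 1 → Set
Total e = ∀ x → ∃ λ y → Eval e (x ∷ []) y

RankableTotal : Subset → Set
RankableTotal A = Σ (PR 1) λ e → Total e × IsRanking e A

-- A recursive set A is the domain of the search for a zero of 1 − χ_A, and
-- x ↦ Σ_{z ≤ x} χ_A(z) is a total ranking function for it.
--
-- Conversely let A = dom e be ranked by f.  If A is bounded, all its elements
-- appear within some fixed number T of steps of e, so running e for T steps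
-- decides A.  Otherwise, for x ∉ A let y₂ be the least element of A above x:
-- either f(y₂) = 1, or f(y₂) = f(y₁) + 1 for the greatest element y₁ < x.
-- Such a certificate, once observed, leaves no room for an element of A
-- strictly between y₁ and y₂.  Running e and f with a growing clock t
-- until x is enumerated or certified absent therefore decides A; the clocked
-- interpreter is itself a μ-recursive program, which makes the search one.

module Submission where

open import Axiom.ExcludedMiddle using (ExcludedMiddle)
open import Data.Empty using (⊥; ⊥-elim)
open import Data.Fin using (Fin) renaming (zero to fz; suc to fs)
open import Data.Nat using (ℕ; zero; suc; pred; _+_; _∸_; _⊔_; _≤_; _<_; z≤n; s≤s; _≤?_)
open import Data.Nat.Properties
  using (≤-refl; ≤-trans; ≤-reflexive; ≤-pred; <⇒≤; <⇒≱; ≰⇒>; <-irrefl; m≤n⇒m≤1+n;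
         m<n⇒m<1+n; m≤n⇒m<n∨m≡n; m≤n+m; +-suc; +-identityʳ; m≤m⊔n; m≤n⊔m; pred[m∸n]≡m∸[1+n])
open import Data.Product using (Σ; ∃; _×_; _,_; proj₁; proj₂)
open import Data.Sum using (_⊎_; inj₁; inj₂; [_,_]′)
open import Data.Unit using (⊤; tt)
open import Data.Vec using (Vec; []; _∷_; lookup; map; tabulate)
open import Function using (_∘_)
open import Function.Bundles using (_⇔_; mk⇔)
open import Level using (0ℓ)
open import Relation.Nullary using (¬_; yes; no)
open import Relation.Binary.PropositionalEquality using (_≡_; refl; sym; trans; cong; cong₂; subst)

open import Defs

ifz : ℕ → ℕ → ℕ → ℕ
ifz zero    b c = b
ifz (suc _) b c = c

ifzProg : PR 3
ifzProg = prec (proj fz) (proj (fs (fs (fs fz))))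

ifzProg-correct : ∀ a b c → Eval ifzProg (a ∷ b ∷ c ∷ []) (ifz a b c)
ifzProg-correct zero    b c = ev-prec-z ev-proj
ifzProg-correct (suc a) b c = ev-prec-s (ifzProg-correct a b c) ev-proj

predProg : PR 1
predProg = prec zer (proj fz)

predProg-correct : ∀ a → Eval predProg (a ∷ []) (pred a)
predProg-correct zero    = ev-prec-z ev-zer
predProg-correct (suc a) = ev-prec-s (predProg-correct a) ev-proj

ifzP : ∀ {k} → PR k → PR k → PR k → PR k
ifzP a b c = comp ifzProg (a ∷ b ∷ c ∷ [])

predP sucP : ∀ {k} → PR k → PR k
predP a = comp predProg (a ∷ [])
sucP a = comp succ (a ∷ [])

oneP : ∀ {k} → PR k
oneP = sucP zer

ev-ifzP : ∀ {k} {a b c : PR k} {xs x y z} →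
  Eval a xs x → Eval b xs y → Eval c xs z → Eval (ifzP a b c) xs (ifz x y z)
ev-ifzP ea eb ec = ev-comp (evv-∷ ea (evv-∷ eb (evv-∷ ec evv-[]))) (ifzProg-correct _ _ _)

ev-predP : ∀ {k} {a : PR k} {xs x} → Eval a xs x → Eval (predP a) xs (pred x)
ev-predP ea = ev-comp (evv-∷ ea evv-[]) (predProg-correct _)

ev-sucP : ∀ {k} {a : PR k} {xs x} → Eval a xs x → Eval (sucP a) xs (suc x)
ev-sucP ea = ev-comp (evv-∷ ea evv-[]) ev-succ

ev-oneP : ∀ {k} {xs : Vec ℕ k} → Eval oneP xs 1
ev-oneP = ev-sucP ev-zer

projs : ∀ {j k} → (Fin j → Fin k) → Vec (PR k) j
projs σ = tabulate (proj ∘ σ)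

projs-correct : ∀ {j k} (σ : Fin j → Fin k) {xs : Vec ℕ k} {ys : Vec ℕ j} →
  (∀ i → lookup xs (σ i) ≡ lookup ys i) → EvalVec (projs σ) xs ys
projs-correct σ {ys = []}     _  = evv-[]
projs-correct σ {ys = y ∷ ys} eq =
  evv-∷ (subst (Eval _ _) (eq fz) ev-proj) (projs-correct (σ ∘ fs) (eq ∘ fs))

-- run t p xs is 0 if p has not converged on xs within clock t, and suc y if it
-- has converged to y.  In the scan for μ, 0 means "still searching", 1 means an
-- undefined value was met, and 2 + y means that y is the least zero.

allDefined : ∀ {m} → Vec ℕ m → ℕ
allDefined []       = 1
allDefined (v ∷ vs) = ifz v 0 (allDefined vs)

runPrec : ℕ → (ℕ → ℕ → ℕ) → ℕ → ℕ
runPrec b s zero    = b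
runPrec b s (suc n) = ifz (runPrec b s n) 0 (s n (pred (runPrec b s n)))

muScan : (ℕ → ℕ) → ℕ → ℕ
muScan ψ zero    = 0
muScan ψ (suc m) = ifz (muScan ψ m) (ifz (ψ m) 1 (ifz (pred (ψ m)) (suc (suc m)) 0)) (muScan ψ m)

muResult : ℕ → ℕ
muResult s = ifz (pred s) 0 (pred s)

mutual
  run : ∀ {k} → ℕ → PR k → Vec ℕ k → ℕ
  run t zer         xs       = 1
  run t succ        (x ∷ []) = suc (suc x)
  run t (proj i)    xs       = suc (lookup xs i)
  run t (comp f gs) xs       = ifz (allDefined (runV t gs xs)) 0 (run t f (map pred (runV t gs xs)))
  run t (prec f g)  (n ∷ xs) = runPrec (run t f xs) (λ m z → run t g (m ∷ z ∷ xs)) n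
  run t (mu f)      xs       = muResult (muScan (λ z → run t f (z ∷ xs)) t)

  runV : ∀ {k m} → ℕ → Vec (PR k) m → Vec ℕ k → Vec ℕ m
  runV t []       xs = []
  runV t (g ∷ gs) xs = run t g xs ∷ runV t gs xs

muResultProg : PR 1
muResultProg = ifzP (predP (proj fz)) zer (predP (proj fz))

mutual
  clocked : ∀ {k} → PR k → PR (suc k)
  clocked zer         = oneP
  clocked succ        = sucP (sucP (proj (fs fz)))
  clocked (proj i)    = sucP (proj (fs i))
  clocked (comp f gs) = ifzP (allDefinedProg gs) zer (comp (clocked f) (proj fz ∷ clockedArgs gs))
  clocked (prec f g)  = comp (prec (clocked f) (precStep g)) (proj (fs fz) ∷ proj fz ∷ projs (fs ∘ fs))
  clocked (mu f)      = comp muResultProg (comp (prec zer (muStep f)) (proj fz ∷ proj fz ∷ projs fs) ∷ [])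

  clockedArgs : ∀ {k m} → Vec (PR k) m → Vec (PR (suc k)) m
  clockedArgs []       = []
  clockedArgs (g ∷ gs) = predP (clocked g) ∷ clockedArgs gs

  allDefinedProg : ∀ {k m} → Vec (PR k) m → PR (suc k)
  allDefinedProg []       = oneP
  allDefinedProg (g ∷ gs) = ifzP (clocked g) zer (allDefinedProg gs)

  -- arguments (n, z, t, xs), where z is the clocked value at n
  precStep : ∀ {k} → PR (suc (suc k)) → PR (suc (suc (suc k)))
  precStep g = ifzP (proj (fs fz)) zer
    (comp (clocked g) (proj (fs (fs fz)) ∷ proj fz ∷ predP (proj (fs fz)) ∷ projs (fs ∘ fs ∘ fs)))

  -- arguments (m, s, t, xs), where s is the scan state after m steps
  muStep : ∀ {k} → PR (suc k) → PR (suc (suc (suc k)))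
  muStep f = ifzP (proj (fs fz)) (ifzP ψ oneP (ifzP (predP ψ) (sucP (sucP (proj fz))) zer)) (proj (fs fz))
    where ψ = comp (clocked f) (proj (fs (fs fz)) ∷ proj fz ∷ projs (fs ∘ fs ∘ fs))

mutual
  clocked-correct : ∀ {k} (p : PR k) t xs → Eval (clocked p) (t ∷ xs) (run t p xs)
  clocked-correct zer         t xs       = ev-oneP
  clocked-correct succ        t (x ∷ []) = ev-sucP (ev-sucP ev-proj)
  clocked-correct (proj i)    t xs       = ev-sucP ev-proj
  clocked-correct (comp f gs) t xs       =
    ev-ifzP (allDefinedProg-correct gs t xs) ev-zer
      (ev-comp (evv-∷ ev-proj (clockedArgs-correct gs t xs)) (clocked-correct f t _))
  clocked-correct (prec f g)  t (n ∷ xs) =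
    ev-comp (evv-∷ ev-proj (evv-∷ ev-proj (projs-correct (fs ∘ fs) (λ _ → refl))))
      (precStep-correct f g t n xs)
  clocked-correct (mu f)      t xs       =
    ev-comp (evv-∷ (ev-comp (evv-∷ ev-proj (evv-∷ ev-proj (projs-correct fs (λ _ → refl))))
                              (muStep-correct f t t xs)) evv-[])
      (ev-ifzP (ev-predP ev-proj) ev-zer (ev-predP ev-proj))

  clockedArgs-correct : ∀ {k m} (gs : Vec (PR k) m) t xs →
    EvalVec (clockedArgs gs) (t ∷ xs) (map pred (runV t gs xs))
  clockedArgs-correct []       t xs = evv-[]
  clockedArgs-correct (g ∷ gs) t xs = evv-∷ (ev-predP (clocked-correct g t xs)) (clockedArgs-correct gs t xs)

  allDefinedProg-correct : ∀ {k m} (gs : Vec (PR k) m) t xs →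
    Eval (allDefinedProg gs) (t ∷ xs) (allDefined (runV t gs xs))
  allDefinedProg-correct []       t xs = ev-oneP
  allDefinedProg-correct (g ∷ gs) t xs =
    ev-ifzP (clocked-correct g t xs) ev-zer (allDefinedProg-correct gs t xs)

  precStep-correct : ∀ {k} (f : PR k) g t n xs →
    Eval (prec (clocked f) (precStep g)) (n ∷ t ∷ xs) (run t (prec f g) (n ∷ xs))
  precStep-correct f g t zero    xs = ev-prec-z (clocked-correct f t xs)
  precStep-correct f g t (suc n) xs = ev-prec-s (precStep-correct f g t n xs)
    (ev-ifzP ev-proj ev-zer
      (ev-comp (evv-∷ ev-proj (evv-∷ ev-proj (evv-∷ (ev-predP ev-proj)
                                                       (projs-correct (fs ∘ fs ∘ fs) (λ _ → refl)))))
        (clocked-correct g t _)))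

  muStep-correct : ∀ {k} (f : PR (suc k)) t m xs →
    Eval (prec zer (muStep f)) (m ∷ t ∷ xs) (muScan (λ z → run t f (z ∷ xs)) m)
  muStep-correct f t zero    xs = ev-prec-z ev-zer
  muStep-correct f t (suc m) xs = ev-prec-s (muStep-correct f t m xs)
    (ev-ifzP ev-proj (ev-ifzP ψ ev-oneP (ev-ifzP (ev-predP ψ) (ev-sucP (ev-sucP ev-proj)) ev-zer)) ev-proj)
    where
    ψ = ev-comp (evv-∷ ev-proj (evv-∷ ev-proj (projs-correct (fs ∘ fs ∘ fs) (λ _ → refl))))
                (clocked-correct f t (m ∷ xs))

muFrom-intro : ∀ {k} {h : PR (suc k)} {xs} d {n y} → d + n ≡ y →
  (∀ z → n ≤ z → z < y → ∃ λ v → Eval h (z ∷ xs) (suc v)) → Eval h (y ∷ xs) 0 → MuFrom h xs n y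
muFrom-intro zero refl _ hy = mu-here hy
muFrom-intro (suc d) {n} eq hz hy =
  mu-next (proj₂ (hz n ≤-refl n<y)) (muFrom-intro d (trans (+-suc d n) eq) (λ z n<z → hz z (<⇒≤ n<z)) hy)
  where
  n<y = subst (n <_) eq (s≤s (m≤n+m n d))

muFrom-zero : ∀ {k} {h : PR (suc k)} {xs n y} → MuFrom h xs n y → Eval h (y ∷ xs) 0
muFrom-zero (mu-here e)   = e
muFrom-zero (mu-next _ m) = muFrom-zero m

module _ (ψ : ℕ → ℕ) where

  muScan-searching : ∀ m → muScan ψ m ≡ 0 → ∀ z → z < m → ∃ λ v → ψ z ≡ suc (suc v)
  muScan-searching (suc m) h z (s≤s z≤m) with muScan ψ m in scan | ψ m in val
  muScan-searching (suc m) () z _ | suc _ | _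
  muScan-searching (suc m) () z _ | zero  | zero
  muScan-searching (suc m) () z _ | zero  | suc zero
  ... | zero | suc (suc v) with m≤n⇒m<n∨m≡n z≤m
  ...   | inj₁ z<m  = muScan-searching m scan z z<m
  ...   | inj₂ refl = v , val

  muScan-found : ∀ m y → muScan ψ m ≡ suc (suc y) →
    y < m × ψ y ≡ 1 × (∀ z → z < y → ∃ λ v → ψ z ≡ suc (suc v))
  muScan-found (suc m) y h with muScan ψ m in scan | ψ m in val
  muScan-found (suc m) y () | zero | zero
  muScan-found (suc m) y refl | zero | suc zero = ≤-refl , val , muScan-searching m scan
  muScan-found (suc m) y () | zero | suc (suc _)
  muScan-found (suc m) y h | suc _ | _ with muScan-found m y (trans scan h)
  ... | y<m , found , before = m<n⇒m<1+n y<m , found , before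

  module _ (y : ℕ) (before : ∀ z → z < y → ∃ λ v → ψ z ≡ suc (suc v)) (found : ψ y ≡ 1) where

    muScan-before : ∀ m → m ≤ y → muScan ψ m ≡ 0
    muScan-before zero    _ = refl
    muScan-before (suc m) m<y
      rewrite muScan-before m (<⇒≤ m<y) | proj₂ (before m m<y) = refl

    muScan-after : ∀ m → y < m → muScan ψ m ≡ suc (suc y)
    muScan-after (suc m) (s≤s y≤m) with m≤n⇒m<n∨m≡n y≤m
    ... | inj₁ y<m  rewrite muScan-after m y<m = refl
    ... | inj₂ refl rewrite muScan-before y ≤-refl | found = refl

muResult-inverse : ∀ s {y} → muResult s ≡ suc y → s ≡ suc (suc y)
muResult-inverse (suc (suc s)) refl = refl

mutual
  run-sound : ∀ {k} (p : PR k) t xs y → run t p xs ≡ suc y → Eval p xs y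
  run-sound zer      t xs       .0                refl = ev-zer
  run-sound succ     t (x ∷ []) .(suc x)          refl = ev-succ
  run-sound (proj i) t xs       .(lookup xs i)    refl = ev-proj
  run-sound (comp f gs) t xs y h with allDefined (runV t gs xs) in defined
  run-sound (comp f gs) t xs y () | zero
  ... | suc _ = ev-comp (runV-sound gs t xs defined) (run-sound f t _ y h)
  run-sound (prec f g) t (n ∷ xs) y h = runPrec-sound f g t xs n y h
  run-sound (mu f) t xs y h
    with muScan-found (λ z → run t f (z ∷ xs)) t y (muResult-inverse _ h)
  ... | _ , found , before =
    ev-mu (muFrom-intro y (+-identityʳ y)
             (λ z _ z<y → let v , eq = before z z<y in v , run-sound f t (z ∷ xs) (suc v) eq)
             (run-sound f t (y ∷ xs) 0 found))

  runV-sound : ∀ {k m} (gs : Vec (PR k) m) t xs {a} →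
    allDefined (runV t gs xs) ≡ suc a → EvalVec gs xs (map pred (runV t gs xs))
  runV-sound []       t xs h = evv-[]
  runV-sound (g ∷ gs) t xs h with run t g xs in val
  runV-sound (g ∷ gs) t xs () | zero
  ... | suc v = evv-∷ (run-sound g t xs v val) (runV-sound gs t xs h)

  runPrec-sound : ∀ {k} (f : PR k) g t xs n y → run t (prec f g) (n ∷ xs) ≡ suc y → Eval (prec f g) (n ∷ xs) y
  runPrec-sound f g t xs zero    y h = ev-prec-z (run-sound f t xs y h)
  runPrec-sound f g t xs (suc n) y h with run t (prec f g) (n ∷ xs) in previous
  runPrec-sound f g t xs (suc n) y () | zero
  ... | suc z = ev-prec-s (runPrec-sound f g t xs n z previous) (run-sound g t (n ∷ z ∷ xs) y h)

Eventually : (ℕ → Set) → Set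
Eventually P = Σ ℕ λ t₀ → ∀ t → t₀ ≤ t → P t

eventually-map : ∀ {P Q : ℕ → Set} → (∀ {t} → P t → Q t) → Eventually P → Eventually Q
eventually-map f (t₀ , p) = t₀ , λ t t₀≤t → f (p t t₀≤t)

eventually-zipWith : ∀ {P Q R : ℕ → Set} → (∀ {t} → P t → Q t → R t) →
  Eventually P → Eventually Q → Eventually R
eventually-zipWith f (t₀ , p) (t₁ , q) =
  t₀ ⊔ t₁ , λ t h → f (p t (≤-trans (m≤m⊔n t₀ t₁) h)) (q t (≤-trans (m≤n⊔m t₀ t₁) h))

infixr 4 _⟨×⟩_
_⟨×⟩_ : ∀ {P Q : ℕ → Set} → Eventually P → Eventually Q → Eventually (λ t → P t × Q t)
_⟨×⟩_ = eventually-zipWith _,_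

eventually-≥ : ∀ n → Eventually (n ≤_)
eventually-≥ n = n , λ _ h → h

eventually-∀< : ∀ {P : ℕ → ℕ → Set} n → (∀ y → y < n → Eventually (P y)) →
  Eventually (λ t → ∀ y → y < n → P y t)
eventually-∀< zero    _  = 0 , λ _ _ _ ()
eventually-∀< {P} (suc n) ev =
  eventually-zipWith combine (eventually-∀< n (λ y y<n → ev y (m<n⇒m<1+n y<n))) (ev n ≤-refl)
  where
  combine : ∀ {t} → (∀ y → y < n → P y t) → P n t → ∀ y → y < suc n → P y t
  combine below at y (s≤s y≤n) with m≤n⇒m<n∨m≡n y≤n
  ... | inj₁ y<n  = below y y<n
  ... | inj₂ refl = at

eventually-witness : ∀ {P : ℕ → Set} → Eventually P → ∃ P
eventually-witness (t₀ , p) = t₀ , p t₀ ≤-refl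

allDefined-suc : ∀ {m} (ys : Vec ℕ m) → allDefined (map suc ys) ≡ 1
allDefined-suc []       = refl
allDefined-suc (y ∷ ys) = allDefined-suc ys

map-pred-suc : ∀ {m} (ys : Vec ℕ m) → map pred (map suc ys) ≡ ys
map-pred-suc []       = refl
map-pred-suc (y ∷ ys) = cong (y ∷_) (map-pred-suc ys)

run-comp : ∀ {k m} {f : PR m} {gs : Vec (PR k) m} {xs ys y t} →
  runV t gs xs ≡ map suc ys → run t f ys ≡ suc y → run t (comp f gs) xs ≡ suc y
run-comp {ys = ys} args value rewrite args | allDefined-suc ys | map-pred-suc ys = value

run-prec-suc : ∀ {k} {f : PR k} {g xs n z y t} →
  run t (prec f g) (n ∷ xs) ≡ suc z → run t g (n ∷ z ∷ xs) ≡ suc y → run t (prec f g) (suc n ∷ xs) ≡ suc y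
run-prec-suc {g = g} {xs} {n} {t = t} previous step =
  trans (cong (λ w → ifz w 0 (run t g (n ∷ pred w ∷ xs))) previous) step

MuFoundBy : ∀ {k} → PR (suc k) → Vec ℕ k → ℕ → ℕ → ℕ → Set
MuFoundBy f xs n y t =
  y < t × (∀ z → n ≤ z → z < y → ∃ λ v → run t f (z ∷ xs) ≡ suc (suc v)) × run t f (y ∷ xs) ≡ 1

mutual
  run-complete : ∀ {k} {p : PR k} {xs y} → Eval p xs y → Eventually (λ t → run t p xs ≡ suc y)
  run-complete ev-zer           = 0 , λ _ _ → refl
  run-complete ev-succ          = 0 , λ _ _ → refl
  run-complete ev-proj          = 0 , λ _ _ → refl
  run-complete (ev-comp {f = f} {gs} args e) =
    eventually-zipWith (run-comp {f = f} {gs}) (runV-complete args) (run-complete e)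
  run-complete (ev-prec-z e)    = run-complete e
  run-complete (ev-prec-s {f = f} {g} {n} {xs} r e) =
    eventually-zipWith (run-prec-suc {f = f} {g} {xs} {n}) (run-complete r) (run-complete e)
  run-complete (ev-mu {f = f} {xs} {y} m) = eventually-map found (muFrom-complete m)
    where
    found : ∀ {t} → MuFoundBy f xs 0 y t → run t (mu f) xs ≡ suc y
    found {t} (y<t , before , at) =
      cong muResult (muScan-after (λ z → run t f (z ∷ xs)) y (λ z → before z z≤n) at t y<t)

  runV-complete : ∀ {k m} {gs : Vec (PR k) m} {xs ys} → EvalVec gs xs ys →
    Eventually (λ t → runV t gs xs ≡ map suc ys)
  runV-complete evv-[]       = 0 , λ _ _ → refl
  runV-complete (evv-∷ e es) = eventually-zipWith (cong₂ _∷_) (run-complete e) (runV-complete es)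

  muFrom-complete : ∀ {k} {f : PR (suc k)} {xs n y} → MuFrom f xs n y → Eventually (MuFoundBy f xs n y)
  muFrom-complete (mu-here {n = n} e) =
    eventually-zipWith (λ n<t at → n<t , (λ z n≤z z<n → ⊥-elim (<⇒≱ z<n n≤z)) , at)
      (eventually-≥ (suc n)) (run-complete e)
  muFrom-complete (mu-next {f = f} {xs} {n} {v} {y} e m) =
    eventually-zipWith extend (run-complete e) (muFrom-complete m)
    where
    extend : ∀ {t} → run t f (n ∷ xs) ≡ suc (suc v) → MuFoundBy f xs (suc n) y t → MuFoundBy f xs n y t
    extend {t} here (y<t , before , at) = y<t , beforeFrom , at
      where
      beforeFrom : ∀ z → n ≤ z → z < y → ∃ λ w → run t f (z ∷ xs) ≡ suc (suc w)
      beforeFrom z n≤z z<y with m≤n⇒m<n∨m≡n n≤z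
      ... | inj₁ n<z  = before z n<z z<y
      ... | inj₂ refl = v , here

mutual
  eval-deterministic : ∀ {k} {p : PR k} {xs y y′} → Eval p xs y → Eval p xs y′ → y ≡ y′
  eval-deterministic ev-zer          ev-zer            = refl
  eval-deterministic ev-succ         ev-succ           = refl
  eval-deterministic ev-proj         ev-proj           = refl
  eval-deterministic (ev-comp as e)  (ev-comp as′ e′)  with evalVec-deterministic as as′
  ... | refl = eval-deterministic e e′
  eval-deterministic (ev-prec-z e)   (ev-prec-z e′)    = eval-deterministic e e′
  eval-deterministic (ev-prec-s r e) (ev-prec-s r′ e′) with eval-deterministic r r′
  ... | refl = eval-deterministic e e′
  eval-deterministic (ev-mu m)       (ev-mu m′)        = muFrom-deterministic m m′

  evalVec-deterministic : ∀ {k m} {gs : Vec (PR k) m} {xs ys ys′} →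
    EvalVec gs xs ys → EvalVec gs xs ys′ → ys ≡ ys′
  evalVec-deterministic evv-[]       evv-[]         = refl
  evalVec-deterministic (evv-∷ e es) (evv-∷ e′ es′) =
    cong₂ _∷_ (eval-deterministic e e′) (evalVec-deterministic es es′)

  muFrom-deterministic : ∀ {k} {f : PR (suc k)} {xs n y y′} → MuFrom f xs n y → MuFrom f xs n y′ → y ≡ y′
  muFrom-deterministic (mu-here _)   (mu-here _)     = refl
  muFrom-deterministic (mu-here e)   (mu-next e′ _)  with eval-deterministic e e′
  ... | ()
  muFrom-deterministic (mu-next e _) (mu-here e′)    with eval-deterministic e e′
  ... | ()
  muFrom-deterministic (mu-next _ m) (mu-next _ m′)  = muFrom-deterministic m m′

record Computable (k : ℕ) : Set where
  field
    program  : PR k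
    function : Vec ℕ k → ℕ
    computes : ∀ xs → Eval program xs (function xs)
open Computable

sumBelow : ℕ → (ℕ → ℕ) → ℕ
sumBelow zero    P = 0
sumBelow (suc n) P = P n + sumBelow n P

data Ex : ℕ → Set where
  var : ∀ {k} → Fin k → Ex k
  app : ∀ {j k} → Computable j → Vec (Ex k) j → Ex k
  wk  : ∀ {k} → Ex k → Ex (suc k)
  sum : ∀ {k} → Ex k → Ex (suc k) → Ex k

mutual
  eval : ∀ {k} → Ex k → Vec ℕ k → ℕ
  eval (var i)      xs       = lookup xs i
  eval (app c as)   xs       = function c (evalV as xs)
  eval (wk a)       (_ ∷ xs) = eval a xs
  eval (sum n body) xs       = sumBelow (eval n xs) (λ z → eval body (z ∷ xs))

  evalV : ∀ {j k} → Vec (Ex k) j → Vec ℕ k → Vec ℕ j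
  evalV []       xs = []
  evalV (a ∷ as) xs = eval a xs ∷ evalV as xs

plusProg : PR 2
plusProg = prec (proj fz) (sucP (proj (fs fz)))

plusProg-correct : ∀ a b → Eval plusProg (a ∷ b ∷ []) (a + b)
plusProg-correct zero    b = ev-prec-z ev-proj
plusProg-correct (suc a) b = ev-prec-s (plusProg-correct a b) (ev-sucP ev-proj)

sumProg : ∀ {k} → PR (suc k) → PR (suc k)
sumProg body = prec zer (comp plusProg (comp body (proj fz ∷ projs (fs ∘ fs)) ∷ proj (fs fz) ∷ []))

mutual
  compile : ∀ {k} → Ex k → PR k
  compile (var i)      = proj i
  compile (app c as)   = comp (program c) (compileV as)
  compile (wk a)       = comp (compile a) (projs fs)
  compile (sum n body) = comp (sumProg (compile body)) (compile n ∷ projs (λ i → i))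

  compileV : ∀ {j k} → Vec (Ex k) j → Vec (PR k) j
  compileV []       = []
  compileV (a ∷ as) = compile a ∷ compileV as

mutual
  compile-correct : ∀ {k} (a : Ex k) xs → Eval (compile a) xs (eval a xs)
  compile-correct (var i)      xs       = ev-proj
  compile-correct (app c as)   xs       = ev-comp (compileV-correct as xs) (computes c _)
  compile-correct (wk a)       (x ∷ xs) = ev-comp (projs-correct fs (λ _ → refl)) (compile-correct a xs)
  compile-correct (sum n body) xs       =
    ev-comp (evv-∷ (compile-correct n xs) (projs-correct (λ i → i) (λ _ → refl))) (sumProg-correct body xs _)

  compileV-correct : ∀ {j k} (as : Vec (Ex k) j) xs → EvalVec (compileV as) xs (evalV as xs)
  compileV-correct []       xs = evv-[]
  compileV-correct (a ∷ as) xs = evv-∷ (compile-correct a xs) (compileV-correct as xs)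

  sumProg-correct : ∀ {k} (body : Ex (suc k)) xs n →
    Eval (sumProg (compile body)) (n ∷ xs) (sumBelow n (λ z → eval body (z ∷ xs)))
  sumProg-correct body xs zero    = ev-prec-z ev-zer
  sumProg-correct body xs (suc n) = ev-prec-s (sumProg-correct body xs n)
    (ev-comp (evv-∷ (ev-comp (evv-∷ ev-proj (projs-correct (fs ∘ fs) (λ _ → refl)))
                             (compile-correct body (n ∷ xs)))
                    (evv-∷ ev-proj evv-[]))
      (plusProg-correct _ _))

natProg : ∀ {k} → ℕ → PR k
natProg zero    = zer
natProg (suc n) = sucP (natProg n)

natProg-correct : ∀ {k} n {xs : Vec ℕ k} → Eval (natProg n) xs n
natProg-correct zero    = ev-zer
natProg-correct (suc n) = ev-sucP (natProg-correct n)

monusProg : PR 2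
monusProg = comp (prec (proj fz) (predP (proj (fs fz)))) (proj (fs fz) ∷ proj fz ∷ [])

monusProg-correct : ∀ a b → Eval monusProg (a ∷ b ∷ []) (a ∸ b)
monusProg-correct a b = ev-comp (evv-∷ ev-proj (evv-∷ ev-proj evv-[])) (by-recursion b)
  where
  by-recursion : ∀ b → Eval (prec (proj fz) (predP (proj (fs fz)))) (b ∷ a ∷ []) (a ∸ b)
  by-recursion zero    = ev-prec-z ev-proj
  by-recursion (suc b) = ev-prec-s (by-recursion b) (subst (Eval _ _) (pred[m∸n]≡m∸[1+n] a b) (ev-predP ev-proj))

litE : ∀ {k} → ℕ → Ex k
litE n = app (record { program = natProg n ; function = λ _ → n ; computes = λ _ → natProg-correct n }) []

sucE : ∀ {k} → Ex k → Ex k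
sucE a = app (record { program = succ ; function = λ { (x ∷ []) → suc x }
                     ; computes = λ { (x ∷ []) → ev-succ } })
             (a ∷ [])

ifzE : ∀ {k} → Ex k → Ex k → Ex k → Ex k
ifzE a b c = app (record { program = ifzProg ; function = λ { (x ∷ y ∷ z ∷ []) → ifz x y z }
                         ; computes = λ { (x ∷ y ∷ z ∷ []) → ifzProg-correct x y z } })
                 (a ∷ b ∷ c ∷ [])

monusE : ∀ {k} → Ex k → Ex k → Ex k
monusE a b = app (record { program = monusProg ; function = λ { (x ∷ y ∷ []) → x ∸ y }
                         ; computes = λ { (x ∷ y ∷ []) → monusProg-correct x y } })
                 (a ∷ b ∷ [])

Holds : ℕ → Set
Holds zero    = ⊥
Holds (suc _) = ⊤

nzₙ notₙ : ℕ → ℕ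
nzₙ a = ifz a 0 1
notₙ a = ifz a 1 0

andₙ orₙ ltₙ eqₙ : ℕ → ℕ → ℕ
andₙ a b = ifz a 0 (nzₙ b)
orₙ a b = ifz a (nzₙ b) 1
ltₙ a b = nzₙ (b ∸ a)
eqₙ a b = andₙ (notₙ (a ∸ b)) (notₙ (b ∸ a))

nzE notE : ∀ {k} → Ex k → Ex k
nzE a = ifzE a (litE 0) (litE 1)
notE a = ifzE a (litE 1) (litE 0)

andE orE ltE eqE : ∀ {k} → Ex k → Ex k → Ex k
andE a b = ifzE a (litE 0) (nzE b)
orE a b = ifzE a (nzE b) (litE 1)
ltE a b = nzE (monusE b a)
eqE a b = andE (notE (monusE a b)) (notE (monusE b a))

nz-holds : ∀ {a} → Holds (nzₙ a) → Holds a
nz-holds {suc _} _ = tt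

holds-nz : ∀ {a} → Holds a → Holds (nzₙ a)
holds-nz {suc _} _ = tt

nz-true : ∀ {a} → Holds a → nzₙ a ≡ 1
nz-true {suc _} _ = refl

nz-false : ∀ {a} → ¬ Holds a → nzₙ a ≡ 0
nz-false {zero}  _ = refl
nz-false {suc _} h = ⊥-elim (h tt)

not-false : ∀ {a} → notₙ a ≡ 0 → Holds a
not-false {suc _} _ = tt

not-holds : ∀ {a} → Holds a → notₙ a ≡ 0
not-holds {suc _} _ = refl

holds-suc : ∀ {a} → Holds a → ∃ λ b → a ≡ suc b
holds-suc {suc b} _ = b , refl

and-elim : ∀ {a b} → Holds (andₙ a b) → Holds a × Holds b
and-elim {suc _} h = tt , nz-holds h

and-intro : ∀ {a b} → Holds a → Holds b → Holds (andₙ a b)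
and-intro {suc _} _ h = holds-nz h

or-elim : ∀ {a b} → Holds (orₙ a b) → Holds a ⊎ Holds b
or-elim {zero}  h = inj₂ (nz-holds h)
or-elim {suc _} _ = inj₁ tt

or-introˡ : ∀ {a b} → Holds a → Holds (orₙ a b)
or-introˡ {suc _} _ = tt

or-introʳ : ∀ {a b} → Holds b → Holds (orₙ a b)
or-introʳ {zero}  h = holds-nz h
or-introʳ {suc _} _ = tt

lt-elim : ∀ a b → Holds (ltₙ a b) → a < b
lt-elim zero    (suc b) _ = s≤s z≤n
lt-elim (suc a) (suc b) h = s≤s (lt-elim a b h)

lt-intro : ∀ {a b} → a < b → Holds (ltₙ a b)
lt-intro {zero}  {suc b} _         = tt
lt-intro {suc a} {suc b} (s≤s a<b) = lt-intro a<b

eq-elim : ∀ a b → Holds (eqₙ a b) → a ≡ b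
eq-elim zero    zero    _ = refl
eq-elim (suc a) (suc b) h = cong suc (eq-elim a b h)

eq-intro : ∀ {a b} → a ≡ b → Holds (eqₙ a b)
eq-intro {zero}  refl = tt
eq-intro {suc a} refl = eq-intro {a} refl

plus-introˡ : ∀ {a b} → Holds a → Holds (a + b)
plus-introˡ {suc _} _ = tt

plus-introʳ : ∀ a {b} → Holds b → Holds (a + b)
plus-introʳ zero    h = h
plus-introʳ (suc _) _ = tt

sum-elim : ∀ n P → Holds (sumBelow n P) → ∃ λ z → z < n × Holds (P z)
sum-elim (suc n) P h with P n in value
... | suc _ = n , ≤-refl , subst Holds (sym value) tt
... | zero  = let z , z<n , holds = sum-elim n P h in z , m<n⇒m<1+n z<n , holds

sum-intro : ∀ n P {z} → z < n → Holds (P z) → Holds (sumBelow n P)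
sum-intro (suc n) P {z} (s≤s z≤n′) h with m≤n⇒m<n∨m≡n z≤n′
... | inj₁ z<n  = plus-introʳ (P n) (sum-intro n P z<n h)
... | inj₂ refl = plus-introˡ h

mu-finds-zero : ∀ {k} (h : PR (suc k)) (H : ℕ → ℕ) xs → (∀ t → Eval h (t ∷ xs) (H t)) →
  ∀ {t} → H t ≡ 0 → ∃ λ y → Eval (mu h) xs y × H y ≡ 0
mu-finds-zero h H xs computes {t} zero-at =
  let y , found , zero-at-y = search t 0 zero-at′ in y , ev-mu found , zero-at-y
  where
  zero-at′ : H (t + 0) ≡ 0
  zero-at′ = subst (λ w → H w ≡ 0) (sym (+-identityʳ t)) zero-at
  search : ∀ d n → H (d + n) ≡ 0 → ∃ λ y → MuFrom h xs n y × H y ≡ 0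
  search d n zero-later with H n in value
  ... | zero = n , mu-here (subst (Eval h (n ∷ xs)) value (computes n)) , value
  search zero    n zero-later | suc _ with trans (sym value) zero-later
  ... | ()
  search (suc d) n zero-later | suc _ =
    let y , found , zero-at-y = search d (suc n) (subst (λ w → H w ≡ 0) (sym (+-suc d n)) zero-later)
    in y , mu-next (subst (Eval h (n ∷ xs)) value (computes n)) found , zero-at-y

Indicator : Subset → ℕ → ℕ → Set
Indicator A x v = (A x → v ≡ 1) × (¬ A x → v ≡ 0)

decides-at : ∀ {A p x v} → Eval p (x ∷ []) v → Indicator A x v →
  (A x → Eval p (x ∷ []) 1) × (¬ A x → Eval p (x ∷ []) 0)
decides-at ev (member , nonmember) =
  (λ a → subst (Eval _ _) (member a) ev) , (λ na → subst (Eval _ _) (nonmember na) ev)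

recursive-by-expression : ∀ {A} (χ : Ex 1) → (∀ x → Indicator A x (eval χ (x ∷ []))) → Recursive A
recursive-by-expression {A} χ indicator =
  compile χ , λ x → decides-at {A} (compile-correct χ (x ∷ [])) (indicator x)

recursive-by-search : ∀ {A} (stop answer : Ex 2) →
  (∀ x → ∃ λ t → Holds (eval stop (t ∷ x ∷ []))) →
  (∀ t x → Holds (eval stop (t ∷ x ∷ [])) → Indicator A x (eval answer (t ∷ x ∷ []))) →
  Recursive A
recursive-by-search {A} stop answer terminates correct = decider , decide
  where
  decider : PR 1
  decider = comp (compile answer) (mu (compile (notE stop)) ∷ proj fz ∷ [])
  decide : ∀ x → (A x → Eval decider (x ∷ []) 1) × (¬ A x → Eval decider (x ∷ []) 0)
  decide x with terminates x
  ... | t , stops with mu-finds-zero (compile (notE stop)) (λ t → notₙ (eval stop (t ∷ x ∷ []))) (x ∷ [])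
                         (λ t → compile-correct (notE stop) (t ∷ x ∷ [])) (not-holds stops)
  ... | s , first , stopped =
    decides-at {A} (ev-comp (evv-∷ first (evv-∷ ev-proj evv-[])) (compile-correct answer (s ∷ x ∷ [])))
               (correct s x (not-false stopped))

module Counting (A : Subset) where

  count-unique : ∀ {n j k} → CountBelow A n j → CountBelow A n k → j ≡ k
  count-unique cb-zero      cb-zero       = refl
  count-unique (cb-in _ c)  (cb-in _ c′)  = cong suc (count-unique c c′)
  count-unique (cb-in a _)  (cb-out na _) = ⊥-elim (na a)
  count-unique (cb-out na _) (cb-in a _)  = ⊥-elim (na a)
  count-unique (cb-out _ c) (cb-out _ c′) = count-unique c c′

  count-mono : ∀ {m n j k} → CountBelow A m j → m ≤ n → CountBelow A n k → j ≤ k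
  count-mono cm m≤n cn with m≤n⇒m<n∨m≡n m≤n
  ... | inj₂ refl = ≤-reflexive (count-unique cm cn)
  count-mono cm _ (cb-in _ cn)  | inj₁ (s≤s m≤n) = m≤n⇒m≤1+n (count-mono cm m≤n cn)
  count-mono cm _ (cb-out _ cn) | inj₁ (s≤s m≤n) = count-mono cm m≤n cn

  count-last : ∀ {n k} → CountBelow A n (suc k) → ∃ λ y → y < n × A y × CountBelow A (suc y) (suc k)
  count-last (cb-in a c)  = _ , ≤-refl , a , cb-in a c
  count-last (cb-out _ c) = let y , y<n , a , cy = count-last c in y , m<n⇒m<1+n y<n , a , cy

  count-next : ∀ {m n j k} → CountBelow A m j → m ≤ n → CountBelow A n k → j < k →
    ∃ λ y → m ≤ y × y < n × A y × CountBelow A (suc y) (suc j)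
  count-next cm m≤n cn j<k with m≤n⇒m<n∨m≡n m≤n
  ... | inj₂ refl = ⊥-elim (<-irrefl (count-unique cm cn) j<k)
  count-next cm _ (cb-in a cn) (s≤s j≤k) | inj₁ (s≤s m≤n) with m≤n⇒m<n∨m≡n j≤k
  ... | inj₁ j<k  = let y , m≤y , y<n , ay , cy = count-next cm m≤n cn j<k in y , m≤y , m<n⇒m<1+n y<n , ay , cy
  ... | inj₂ refl = _ , m≤n , ≤-refl , a , cb-in a cn
  count-next cm _ (cb-out _ cn) j<k | inj₁ (s≤s m≤n) =
    let y , m≤y , y<n , ay , cy = count-next cm m≤n cn j<k in y , m≤y , m<n⇒m<1+n y<n , ay , cy

module ClassicalCounting (lem : ExcludedMiddle 0ℓ) (A : Subset) where
  open Counting A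

  count-exists : ∀ n → ∃ (CountBelow A n)
  count-exists zero    = 0 , cb-zero
  count-exists (suc n) with count-exists n | lem {A n}
  ... | k , c | yes a  = suc k , cb-in a c
  ... | k , c | no na  = k , cb-out na c

  count-strict : ∀ {m a j k} → CountBelow A m j → m ≤ a → A a → CountBelow A (suc a) k → j < k
  count-strict cm m≤a a ca′ =
    let k , ca = count-exists _ in subst (_ <_) (count-unique (cb-in a ca) ca′) (s≤s (count-mono cm m≤a ca))

  -- The counts below m and up to y differ by one, and y itself accounts for it.
  no-element-between : ∀ {m r x y} → CountBelow A m r → m ≤ x → x < y → A y →
    CountBelow A (suc y) (suc r) → ¬ A x
  no-element-between {x = x} cm m≤x x<y ay cy ax =
    let k , cx = count-exists (suc x)
    in <⇒≱ (count-strict cm m≤x ax cx) (≤-pred (count-strict cx x<y ay cy))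

runE : ∀ {k} → PR 1 → Ex k → Ex k → Ex k
runE p t y = app (record { program  = clocked p
                         ; function = λ { (t ∷ y ∷ []) → run t p (y ∷ []) }
                         ; computes = λ { (t ∷ y ∷ []) → clocked-correct p t (y ∷ []) } })
                 (t ∷ y ∷ [])

-- Everything is observed at clock t.  rankBy t y ≡ suc r says that f(y) = r,
-- so the literal 2 below stands for rank 1.
module Decider (e f : PR 1) where

  enumeratedBy rankBy : ℕ → ℕ → ℕ
  enumeratedBy t y = nzₙ (run t e (y ∷ []))
  rankBy t y = run t f (y ∷ [])

  consecutiveBy gapBy : ℕ → ℕ → ℕ → ℕ
  consecutiveBy t y₂ y₁ =
    andₙ (enumeratedBy t y₁) (andₙ (nzₙ (rankBy t y₁)) (eqₙ (rankBy t y₂) (suc (rankBy t y₁))))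
  gapBy t x y₂ =
    andₙ (ltₙ x y₂) (andₙ (enumeratedBy t y₂)
      (orₙ (eqₙ (rankBy t y₂) 2) (sumBelow x (consecutiveBy t y₂))))

  excludedBy settledBy : ℕ → ℕ → ℕ
  excludedBy t x = sumBelow (suc t) (gapBy t x)
  settledBy t x = orₙ (enumeratedBy t x) (excludedBy t x)

  enumeratedE rankE : ∀ {k} → Ex k → Ex k → Ex k
  enumeratedE t y = nzE (runE e t y)
  rankE t y = runE f t y

  consecutiveE gapE : ∀ {k} → Ex k → Ex k → Ex k → Ex k
  consecutiveE t y₂ y₁ =
    andE (enumeratedE t y₁) (andE (nzE (rankE t y₁)) (eqE (rankE t y₂) (sucE (rankE t y₁))))
  gapE t x y₂ =
    andE (ltE x y₂) (andE (enumeratedE t y₂)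
      (orE (eqE (rankE t y₂) (litE 2)) (sum x (consecutiveE (wk t) (wk y₂) (var fz)))))

  excludedE settledE : ∀ {k} → Ex k → Ex k → Ex k
  excludedE t x = sum (sucE t) (gapE (wk t) (wk x) (var fz))
  settledE t x = orE (enumeratedE t x) (excludedE t x)

Bounded Unbounded : Subset → Set
Bounded A = ∃ λ b → ∀ y → b ≤ y → ¬ A y
Unbounded A = ∀ x → ∃ λ y → x < y × A y

module RecursiveFromRanking (lem : ExcludedMiddle 0ℓ) (A : Subset)
  (e : PR 1) (enumerates : ∀ x → (A x → ∃ λ y → Eval e (x ∷ []) y) × (∃ (λ y → Eval e (x ∷ []) y) → A x))
  (f : PR 1) (ranks : IsRanking f A) where

  open Decider e f
  open Counting A
  open ClassicalCounting lem A

  enumerated-sound : ∀ {t y} → Holds (enumeratedBy t y) → A y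
  enumerated-sound {t} {y} h =
    let v , converged = holds-suc (nz-holds h) in proj₂ (enumerates y) (v , run-sound e t (y ∷ []) v converged)

  enumerated-eventually : ∀ {y} → A y → Eventually (λ t → Holds (enumeratedBy t y))
  enumerated-eventually {y} a =
    let _ , ev = proj₁ (enumerates y) a
    in eventually-map (λ converged → subst (Holds ∘ nzₙ) (sym converged) tt) (run-complete ev)

  rank-sound : ∀ {t y r} → A y → rankBy t y ≡ suc r → CountBelow A (suc y) r
  rank-sound {t} {y} {r} a converged =
    let _ , count , ev = ranks y a
    in subst (CountBelow A (suc y)) (eval-deterministic ev (run-sound f t (y ∷ []) r converged)) count

  rank-eventually : ∀ {y r} → A y → CountBelow A (suc y) r → Eventually (λ t → rankBy t y ≡ suc r)
  rank-eventually {y} a count =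
    let _ , count′ , ev = ranks y a
    in eventually-map (λ converged → trans converged (cong suc (count-unique count′ count))) (run-complete ev)

  consecutive-sound : ∀ {t y₂ y₁} → Holds (consecutiveBy t y₂ y₁) →
    ∃ λ r → CountBelow A (suc y₁) r × rankBy t y₂ ≡ suc (suc r)
  consecutive-sound h =
    let enumerated₁ , rest = and-elim h
        defined₁ , step    = and-elim rest
        r , rank₁          = holds-suc (nz-holds defined₁)
    in r , rank-sound (enumerated-sound enumerated₁) rank₁ , trans (eq-elim _ _ step) (cong suc rank₁)

  gap-sound : ∀ {t x y₂} → Holds (gapBy t x y₂) → ¬ A x
  gap-sound {t} {x} {y₂} h =
    let below , rest          = and-elim h
        enumerated₂ , witness = and-elim rest
        a₂                    = enumerated-sound enumerated₂
        x<y₂                  = lt-elim x y₂ below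
    in [ (λ first → no-element-between cb-zero z≤n x<y₂ a₂ (rank-sound a₂ (eq-elim _ 2 first)))
       , (λ previous → let y₁ , y₁<x , consecutive = sum-elim x (consecutiveBy t y₂) previous
                           _ , count₁ , rank₂      = consecutive-sound consecutive
                       in no-element-between count₁ y₁<x x<y₂ a₂ (rank-sound a₂ rank₂))
       ]′ (or-elim witness)

  excluded-sound : ∀ {t x} → Holds (excludedBy t x) → ¬ A x
  excluded-sound {t} {x} h = let _ , _ , gap = sum-elim (suc t) (gapBy t x) h in gap-sound gap

  consecutive-intro : ∀ {t y₂ y₁ r} → Holds (enumeratedBy t y₁) → rankBy t y₁ ≡ suc r →
    rankBy t y₂ ≡ suc (suc r) → Holds (consecutiveBy t y₂ y₁)
  consecutive-intro enumerated₁ rank₁ rank₂ =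
    and-intro enumerated₁
      (and-intro (subst (Holds ∘ nzₙ) (sym rank₁) tt) (eq-intro (trans rank₂ (cong suc (sym rank₁)))))

  excluded-intro : ∀ {t x y₂} → y₂ ≤ t → x < y₂ → Holds (enumeratedBy t y₂) →
    Holds (orₙ (eqₙ (rankBy t y₂) 2) (sumBelow x (consecutiveBy t y₂))) → Holds (excludedBy t x)
  excluded-intro {t} {x} y₂≤t x<y₂ enumerated₂ witness =
    sum-intro (suc t) (gapBy t x) (s≤s y₂≤t) (and-intro (lt-intro x<y₂) (and-intro enumerated₂ witness))

  -- y₂ is the least element of A above x, and y₁ (if any) the greatest below x.
  excluded-eventually : Unbounded A → ∀ {x} → ¬ A x → Eventually (λ t → Holds (excludedBy t x))
  excluded-eventually unbounded {x} x∉A with count-exists (suc x)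
  ... | k , count-x =
    let w , x<w , a-w   = unbounded x
        _ , count-w     = count-exists (suc w)
        y₂ , x<y₂ , _ , a₂ , count₂ =
          count-next count-x (m≤n⇒m≤1+n x<w) count-w (count-strict count-x x<w a-w count-w)
    in witnessed k count-x x<y₂ a₂ count₂
    where
    witnessed : ∀ k → CountBelow A (suc x) k → ∀ {y₂} → x < y₂ → A y₂ → CountBelow A (suc y₂) (suc k) →
      Eventually (λ t → Holds (excludedBy t x))
    witnessed zero _ {y₂} x<y₂ a₂ count₂ =
      eventually-zipWith
        (λ { y₂≤t (enumerated₂ , rank₂) → excluded-intro y₂≤t x<y₂ enumerated₂ (or-introˡ (eq-intro rank₂)) })
        (eventually-≥ y₂) (enumerated-eventually a₂ ⟨×⟩ rank-eventually a₂ count₂)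
    witnessed (suc j) count-x {y₂} x<y₂ a₂ count₂ with count-last count-x
    ... | y₁ , s≤s y₁≤x , a₁ , count₁ with m≤n⇒m<n∨m≡n y₁≤x
    ...   | inj₂ refl = ⊥-elim (x∉A a₁)
    ...   | inj₁ y₁<x =
      eventually-zipWith
        (λ { y₂≤t ((enumerated₂ , rank₂) , (enumerated₁ , rank₁)) →
             excluded-intro y₂≤t x<y₂ enumerated₂ (or-introʳ {eqₙ (rankBy _ y₂) 2}
               (sum-intro x (consecutiveBy _ y₂) y₁<x (consecutive-intro enumerated₁ rank₁ rank₂))) })
        (eventually-≥ y₂)
        ((enumerated-eventually a₂ ⟨×⟩ rank-eventually a₂ count₂) ⟨×⟩
         (enumerated-eventually a₁ ⟨×⟩ rank-eventually a₁ count₁))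

  enumerated-indicator : ∀ {t x} → (A x → Holds (enumeratedBy t x)) → Indicator A x (enumeratedBy t x)
  enumerated-indicator complete =
    (λ a → nz-true (nz-holds (complete a))) , (λ x∉A → nz-false (λ h → x∉A (enumerated-sound (holds-nz h))))

  recursive-if-bounded : Bounded A → Recursive A
  recursive-if-bounded (b , beyond) =
    let T , enumerated = eventually-witness (eventually-∀< b (λ y _ → enumerated-eventually-if-member y))
    in recursive-by-expression (enumeratedE (litE T) (var fz))
         (λ x → enumerated-indicator (all-enumerated enumerated x))
    where
    enumerated-eventually-if-member : ∀ y → Eventually (λ t → A y → Holds (enumeratedBy t y))
    enumerated-eventually-if-member y with lem {A y}
    ... | yes a  = eventually-map (λ h _ → h) (enumerated-eventually a)
    ... | no y∉A = 0 , λ _ _ a → ⊥-elim (y∉A a)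
    all-enumerated : ∀ {t} → (∀ y → y < b → A y → Holds (enumeratedBy t y)) →
      ∀ y → A y → Holds (enumeratedBy t y)
    all-enumerated below y with b ≤? y
    ... | yes b≤y = λ a → ⊥-elim (beyond y b≤y a)
    ... | no  b≰y = below y (≰⇒> b≰y)

  recursive-if-unbounded : Unbounded A → Recursive A
  recursive-if-unbounded unbounded =
    recursive-by-search (settledE (var fz) (var (fs fz))) (enumeratedE (var fz) (var (fs fz))) settles
      (λ t x settled → enumerated-indicator
         (λ a → [ (λ h → h) , (λ h → ⊥-elim (excluded-sound h a)) ]′ (or-elim settled)))
    where
    settles : ∀ x → ∃ λ t → Holds (settledBy t x)
    settles x with lem {A x}
    ... | yes a  = eventually-witness (eventually-map or-introˡ (enumerated-eventually a))
    ... | no x∉A =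
      eventually-witness (eventually-map (or-introʳ {enumeratedBy _ x}) (excluded-eventually unbounded x∉A))

  unbounded-if-not-bounded : ¬ Bounded A → Unbounded A
  unbounded-if-not-bounded not-bounded x with lem {∃ λ y → x < y × A y}
  ... | yes above = above
  ... | no none   = ⊥-elim (not-bounded (suc x , λ y x<y a → none (y , x<y , a)))

  recursive : Recursive A
  recursive with lem {Bounded A}
  ... | yes bounded     = recursive-if-bounded bounded
  ... | no not-bounded  = recursive-if-unbounded (unbounded-if-not-bounded not-bounded)

module FromDecider (lem : ExcludedMiddle 0ℓ) (A : Subset) (c : PR 1)
  (decides : ∀ x → (A x → Eval c (x ∷ []) 1) × (¬ A x → Eval c (x ∷ []) 0)) where

  χ : ℕ → ℕ
  χ x with lem {A x}
  ... | yes _ = 1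
  ... | no  _ = 0

  χ-computed : ∀ x → Eval c (x ∷ []) (χ x)
  χ-computed x with lem {A x}
  ... | yes a  = proj₁ (decides x) a
  ... | no x∉A = proj₂ (decides x) x∉A

  χ-member : ∀ {x} → A x → χ x ≡ 1
  χ-member {x} a with lem {A x}
  ... | yes _  = refl
  ... | no x∉A = ⊥-elim (x∉A a)

  χ-holds : ∀ {x} → Holds (χ x) → A x
  χ-holds {x} h with lem {A x}
  ... | yes a = a

  χE : ∀ {k} → Ex k → Ex k
  χE a = app (record { program = c ; function = λ { (x ∷ []) → χ x }
                     ; computes = λ { (x ∷ []) → χ-computed x } })
             (a ∷ [])

  recEnum : RecEnum A
  recEnum = mu (compile halts) , λ x → member x , nonmember x
    where
    halts : Ex 2
    halts = notE (χE (var (fs fz)))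
    member : ∀ x → A x → ∃ λ y → Eval (mu (compile halts)) (x ∷ []) y
    member x a =
      0 , ev-mu (mu-here (subst (Eval _ _) (cong notₙ (χ-member a)) (compile-correct halts (0 ∷ x ∷ []))))
    nonmember : ∀ x → (∃ λ y → Eval (mu (compile halts)) (x ∷ []) y) → A x
    nonmember x (y , ev-mu m) =
      χ-holds (not-false (eval-deterministic (compile-correct halts (y ∷ x ∷ [])) (muFrom-zero m)))

  count-χ : ∀ n → CountBelow A n (sumBelow n χ)
  count-χ zero    = cb-zero
  count-χ (suc n) with lem {A n}
  ... | yes a  = cb-in a (count-χ n)
  ... | no n∉A = cb-out n∉A (count-χ n)

  rankableTotal : RankableTotal A
  rankableTotal = compile ranker , (λ x → _ , compile-correct ranker (x ∷ [])) ,
                  λ x _ → _ , count-χ (suc x) , compile-correct ranker (x ∷ [])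
    where
    ranker : Ex 1
    ranker = sum (sucE (var fz)) (χE (var fz))

theorem9 : ExcludedMiddle 0ℓ → (A : Subset) →
    ((RecEnum A × RankablePartial A) → Recursive A)
    × (Recursive A ⇔ (RecEnum A × RankablePartial A))
    × (Recursive A ⇔ (RecEnum A × RankableTotal A))
theorem9 lem A = recursive , mk⇔ (λ r → recEnum r , partial (rankableTotal r)) recursive
                           , mk⇔ (λ r → recEnum r , rankableTotal r) (λ (re , rt) → recursive (re , partial rt))
  where
  recEnum : Recursive A → RecEnum A
  recEnum (c , decides) = FromDecider.recEnum lem A c decides
  rankableTotal : Recursive A → RankableTotal A
  rankableTotal (c , decides) = FromDecider.rankableTotal lem A c decides
  partial : RankableTotal A → RankablePartial A
  partial (f , _ , ranks) = f , ranks
  recursive : RecEnum A × RankablePartial A → Recursive A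
  recursive ((e , enumerates) , (f , ranks)) = RecursiveFromRanking.recursive lem A e enumerates f ranks
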